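{- Let $a$ and $b$ be positive integers. Then there exists a connected graph $G$ such that $src(G)=a$ and $src^\ell(G)=b$ if and only if $a=b=1$ or $2\le a\le b$.
   Context: All graphs are finite, simple and undirected. An edge-coloured path is rainbow if all its edges have distinct colours; a geodesic is a shortest path between its endpoints. An (not necessarily proper) edge-colouring of a connected graph $G$ is strongly rainbow connected if any two vertices are joined by a rainbow geodesic; $src(G)$ is the minimum number of colours in such a colouring. An $r$-edge-list assignment of $G$ assigns to each edge $e$ a set $L(e)\subset\mathbb N$ with $|L(e)|\ge r$; an $L$-edge-colouring is an edge-colouring $c$ with $c(e)\in L(e)$ for all $e$. $src^\ell(G)$ is the minimum integer $r$ such that for every $r$-edge-list assignment $L$ of $G$ there exists a strongly rainbow connected $L$-edge-colouring of $G$. -}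

module Defs where

open import Data.Nat using (ℕ; zero; suc; _≤_; _<_)
open import Data.Fin using (Fin)
open import Data.Bool using (Bool; true; false; T)
open import Data.List using (List; []; _∷_; length)
open import Data.List.Membership.Propositional using (_∈_)
open import Data.List.Relation.Unary.Unique.Propositional using (Unique)
open import Data.Product using (Σ; ∃; _×_; _,_)
open import Relation.Binary.PropositionalEquality using (_≡_)

record Graph : Set where
  field
    n      : ℕ
    adj    : Fin n → Fin n → Bool
    adj-sym    : ∀ u v → adj u v ≡ adj v u
    adj-irrefl : ∀ u → adj u u ≡ false

module _ (G : Graph) where
  open Graph G

  V : Set
  V = Fin n

  Adj : V → V → Set
  Adj u v = T (adj u v)

  data Walk : V → V → Set where
    stop : ∀ {u} → Walk u u
    step : ∀ {u w v} → Adj u w → Walk w v → Walk u v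

  len : ∀ {u v} → Walk u v → ℕ
  len stop       = 0
  len (step _ p) = suc (len p)

  vertices : ∀ {u v} → Walk u v → List V
  vertices {u} stop       = u ∷ []
  vertices {u} (step _ p) = u ∷ vertices p

  IsPath : ∀ {u v} → Walk u v → Set
  IsPath p = Unique (vertices p)

  Connected : Set
  Connected = ∀ (u v : V) → Σ (Walk u v) IsPath

  IsGeodesic : ∀ {u v} → Walk u v → Set
  IsGeodesic {u} {v} p = IsPath p × (∀ (q : Walk u v) → IsPath q → len p ≤ len q)

  -- An edge-colouring is a function on vertex pairs whose values on
  -- edges are symmetric (so it is a function of the unordered edge);
  -- values on non-adjacent pairs are irrelevant.
  EdgeColouring : Set
  EdgeColouring = V → V → ℕ

  IsSymmetricOnEdges : {A : Set} → (V → V → A) → Set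
  IsSymmetricOnEdges f = ∀ u v → Adj u v → f u v ≡ f v u

  colours : EdgeColouring → ∀ {u v} → Walk u v → List ℕ
  colours c stop                 = []
  colours c (step {u} {w} _ p)   = c u w ∷ colours c p

  IsRainbow : EdgeColouring → ∀ {u v} → Walk u v → Set
  IsRainbow c p = Unique (colours c p)

  StronglyRainbowConnected : EdgeColouring → Set
  StronglyRainbowConnected c =
    IsSymmetricOnEdges c ×
    (∀ (u v : V) → Σ (Walk u v) λ p → IsGeodesic p × IsRainbow c p)

  UsesAtMost : ℕ → EdgeColouring → Set
  UsesAtMost k c = ∀ u v → Adj u v → c u v < k

  SRCColourable : ℕ → Set
  SRCColourable k = ∃ λ c → UsesAtMost k c × StronglyRainbowConnected c

  SrcIs : ℕ → Set
  SrcIs a = SRCColourable a × (∀ k → SRCColourable k → a ≤ k)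

  -- r-edge-list assignment: each edge gets a finite set (list without
  -- repetition) of at least r natural numbers, depending only on the edge
  EdgeListAssignment : Set
  EdgeListAssignment = V → V → List ℕ

  IsRListAssignment : ℕ → EdgeListAssignment → Set
  IsRListAssignment r L =
    IsSymmetricOnEdges L ×
    (∀ u v → Adj u v → Unique (L u v) × r ≤ length (L u v))

  IsLColouring : EdgeListAssignment → EdgeColouring → Set
  IsLColouring L c = ∀ u v → Adj u v → c u v ∈ L u v

  SRCListColourable : ℕ → Set
  SRCListColourable r =
    ∀ (L : EdgeListAssignment) → IsRListAssignment r L →
      ∃ λ c → IsLColouring L c × StronglyRainbowConnected c

  SrcListIs : ℕ → Set
  SrcListIs b = SRCListColourable b × (∀ r → SRCListColourable r → b ≤ r)

  Nonempty : Set
  Nonempty = 1 ≤ n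

{-# OPTIONS --safe #-}
module Submission where

-- The witnesses are cones: an apex joined to every vertex of a disjoint union of cliques.
-- Vertices in different cliques are at distance 2 with the apex as only common neighbour, so a
-- colouring is strongly rainbow connected iff apex edges into different cliques get different
-- colours, and src is the number of cliques. For 2 ≤ a ≤ b take b - 1 vertices spread over
-- a - 1 cliques, and a last clique with one vertex for each function Fin (b - 1) → Fin (b - 1).
-- Lists of size b are coloured greedily. Lists of size b - 1 are not: give the b - 1 vertices
-- pairwise disjoint lists and every vertex of the last clique a transversal of these lists, one
-- transversal per function; then the transversal of the colours chosen on the b - 1 vertices
-- leaves its vertex no admissible colour. Conversely src ≤ srcℓ, and src = 1 forces G to be
-- complete, so that srcℓ = 1.

open import Defs
open import Data.Bool using (Bool; true; false)
open import Data.Bool.Properties using (T?)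
open import Data.Nat using (ℕ; zero; suc; _+_; _^_; _≤_; _<_; _⊓_; z≤n; s≤s; s≤s⁻¹; _≟_; _≤?_)
open import Data.Nat.Properties using (≤-trans; ≤-refl; ≤-reflexive; ≤-antisym; n≤1+n; m⊓n≤n; m≤n⇒m⊓n≡m; <⇒≢; ≰⇒>; n<1⇒n≡0)
open import Data.Fin using (Fin; toℕ; fromℕ<; _↑ˡ_; _↑ʳ_; splitAt; combine; finToFun; funToFin) renaming (zero to fzero; suc to fsuc)
open import Data.Fin.Properties using (suc-injective; toℕ-injective; toℕ<n; toℕ-fromℕ<; pigeonhole; splitAt-↑ˡ; splitAt-↑ʳ; splitAt⁻¹-↑ˡ; splitAt⁻¹-↑ʳ; combine-injectiveˡ; combine-injectiveʳ; finToFun-funToFin) renaming (_≟_ to _≟ᶠ_)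
open import Data.List using (List; []; _∷_; length; filter; tabulate; upTo)
open import Data.List.Properties using (filter-notAll; length-tabulate; length-upTo)
open import Data.List.Membership.Propositional using (_∈_; _∉_)
open import Data.List.Membership.Propositional.Properties using (∈-filter⁺; ∈-tabulate⁺; ∈-tabulate⁻; ∈-upTo⁻)
open import Data.List.Membership.DecPropositional _≟_ using (_∈?_)
open import Data.List.Relation.Unary.All as All using ([]; _∷_)
open import Data.List.Relation.Unary.AllPairs using ([]; _∷_)
open import Data.List.Relation.Unary.Any as Any using (here; there)
open import Data.List.Relation.Unary.Unique.Propositional using (Unique)
open import Data.List.Relation.Unary.Unique.Propositional.Properties using (tabulate⁺; upTo⁺)
open import Data.Product using (Σ; ∃; _×_; _,_; proj₁; proj₂)
open import Data.Sum using (_⊎_; inj₁; inj₂; [_,_]′)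
open import Data.Unit using (tt)
open import Function.Base using (_∘_; _∘′_; id)
open import Function.Bundles using (_⇔_; mk⇔)
open import Function.Definitions using (Injective)
open import Relation.Binary.Definitions using (Decidable)
open import Relation.Nullary using (¬_; yes; no; does; contradiction; ¬?; _×-dec_)
open import Relation.Nullary.Decidable using (⌊_⌋; isYes≗does; does-⇔; dec-false; toWitness; fromWitness)
open import Relation.Binary.PropositionalEquality using (_≡_; _≢_; refl; sym; trans; cong; subst; module ≡-Reasoning)

pigeonhole-∉ : ∀ {xs ys : List ℕ} → Unique xs → length ys < length xs →
               ∃ λ x → x ∈ xs × x ∉ ys
pigeonhole-∉ {x ∷ xs} {ys} (x∉xs ∷ xs!) ys<x∷xs with x ∈? ys
... | no x∉ys = x , here refl , x∉ys
... | yes x∈ys =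
  let z , z∈xs , z∉ys-x = pigeonhole-∉ xs! ys-x<xs
  in  z , there z∈xs , λ z∈ys → z∉ys-x (∈-filter⁺ x≢? z∈ys (All.lookup x∉xs z∈xs))
  where
  x≢? = λ w → ¬? (x ≟ w)
  ys-x<xs : length (filter x≢? ys) < length xs
  ys-x<xs = ≤-trans (filter-notAll x≢? ys (Any.map (λ x≡w x≢w → x≢w x≡w) x∈ys)) (s≤s⁻¹ ys<x∷xs)

distinct-representatives : ∀ s (ℓ : Fin s → List ℕ) →
                           (∀ i → Unique (ℓ i)) → (∀ i → s ≤ length (ℓ i)) →
                           ∃ λ (f : Fin s → ℕ) → (∀ i → f i ∈ ℓ i) × Injective _≡_ _≡_ f
distinct-representatives zero    ℓ ℓ! ℓ-long = (λ ()) , (λ ()) , λ { {()} }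
distinct-representatives (suc s) ℓ ℓ! ℓ-long
  with g , g∈ , g-inj ← distinct-representatives s (ℓ ∘′ fsuc) (λ i → ℓ! (fsuc i))
                           (λ i → ≤-trans (n≤1+n s) (ℓ-long (fsuc i)))
  with x , x∈ , x∉g ← pigeonhole-∉ (ℓ! fzero)
                        (subst (_< length (ℓ fzero)) (sym (length-tabulate g)) (ℓ-long fzero))
  = f , f∈ , f-inj
  where
  f : Fin (suc s) → ℕ
  f fzero    = x
  f (fsuc i) = g i

  f∈ : ∀ i → f i ∈ ℓ i
  f∈ fzero    = x∈
  f∈ (fsuc i) = g∈ i

  x≢g : ∀ j → x ≢ g j
  x≢g j x≡gj = x∉g (subst (_∈ tabulate g) (sym x≡gj) (∈-tabulate⁺ j))

  f-inj : Injective _≡_ _≡_ f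
  f-inj {fzero}  {fzero}  _ = refl
  f-inj {fzero}  {fsuc j} e = contradiction e (x≢g j)
  f-inj {fsuc i} {fzero}  e = contradiction (sym e) (x≢g i)
  f-inj {fsuc i} {fsuc j} e = cong fsuc (g-inj e)

head₀ : List ℕ → ℕ
head₀ []      = 0
head₀ (x ∷ _) = x

head₀-∈ : ∀ {xs} → 1 ≤ length xs → head₀ xs ∈ xs
head₀-∈ {_ ∷ _} _ = here refl

module _ (G : Graph) where

  RainbowGeodesic : EdgeColouring G → V G → V G → Set
  RainbowGeodesic c u v = Σ (Walk G u v) λ p → IsGeodesic G p × IsRainbow G c p

  Complete : Set
  Complete = ∀ u v → u ≢ v → Adj G u v

  len-≢ : ∀ {u v} → u ≢ v → (p : Walk G u v) → 1 ≤ len G p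
  len-≢ u≢v stop       = contradiction refl u≢v
  len-≢ u≢v (step _ _) = s≤s z≤n

  len-¬Adj : ∀ {u v} → u ≢ v → ¬ Adj G u v → (p : Walk G u v) → 2 ≤ len G p
  len-¬Adj u≢v _    stop                = contradiction refl u≢v
  len-¬Adj u≢v ¬uv  (step uv stop)      = contradiction uv ¬uv
  len-¬Adj u≢v ¬uv  (step _ (step _ _)) = s≤s (s≤s z≤n)

  step²-isPath : ∀ {u w v} (uw : Adj G u w) (wv : Adj G w v) → u ≢ w → w ≢ v → u ≢ v →
                 IsPath G (step uw (step wv stop))
  step²-isPath _ _ u≢w w≢v u≢v = (u≢w ∷ u≢v ∷ []) ∷ (w≢v ∷ []) ∷ [] ∷ []

  rainbowGeodesic-refl : ∀ c u → RainbowGeodesic c u u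
  rainbowGeodesic-refl c u = stop , ([] ∷ [] , λ _ _ → z≤n) , []

  rainbowGeodesic-edge : ∀ c {u v} → u ≢ v → Adj G u v → RainbowGeodesic c u v
  rainbowGeodesic-edge c u≢v uv = step uv stop , ((u≢v ∷ []) ∷ [] ∷ [] , λ q _ → len-≢ u≢v q) , [] ∷ []

  rainbowGeodesic-step² : ∀ c {u w v} (uw : Adj G u w) (wv : Adj G w v) → u ≢ w → w ≢ v → u ≢ v →
                          ¬ Adj G u v → c u w ≢ c w v → RainbowGeodesic c u v
  rainbowGeodesic-step² c uw wv u≢w w≢v u≢v ¬uv cuw≢cwv =
    step uw (step wv stop) ,
    (step²-isPath uw wv u≢w w≢v u≢v , λ q _ → len-¬Adj u≢v ¬uv q) ,
    (cuw≢cwv ∷ []) ∷ [] ∷ []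

  SRC⇒Connected : ∀ {c} → StronglyRainbowConnected G c → Connected G
  SRC⇒Connected (_ , rainbow) u v = let p , (p-path , _) , _ = rainbow u v in p , p-path

  SrcIs⇒Connected : ∀ {a} → SrcIs G a → Connected G
  SrcIs⇒Connected ((_ , _ , src) , _) = SRC⇒Connected src

  SRCListColourable-mono : ∀ {r r′} → r ≤ r′ → SRCListColourable G r → SRCListColourable G r′
  SRCListColourable-mono r≤r′ colour L (L-sym , L-ok) =
    colour L (L-sym , λ u v uv → proj₁ (L-ok u v uv) , ≤-trans r≤r′ (proj₂ (L-ok u v uv)))

  SRCListColourable⇒SRCColourable : ∀ {r} → SRCListColourable G r → SRCColourable G r
  SRCListColourable⇒SRCColourable {r} colour =
    let c , c∈ , src = colour (λ _ _ → upTo r)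
                         ((λ _ _ _ → refl) , λ _ _ _ → upTo⁺ r , ≤-reflexive (sym (length-upTo r)))
    in  c , (λ u v uv → ∈-upTo⁻ (c∈ u v uv)) , src

  src≤srcℓ : ∀ {a r} → SrcIs G a → SRCListColourable G r → a ≤ r
  src≤srcℓ (_ , minimal) colour = minimal _ (SRCListColourable⇒SRCColourable colour)

  SrcListIs-suc : ∀ {r} → SRCListColourable G (suc r) → ¬ SRCListColourable G r → SrcListIs G (suc r)
  SrcListIs-suc {r} colour ¬colour = colour , minimal
    where
    minimal : ∀ r′ → SRCListColourable G r′ → suc r ≤ r′
    minimal r′ colour′ with suc r ≤? r′
    ... | yes r<r′ = r<r′
    ... | no  r≮r′ = contradiction (SRCListColourable-mono (s≤s⁻¹ (≰⇒> r≮r′)) colour′) ¬colour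

  -- With one colour a rainbow path has at most one edge.
  SRCColourable-1⇒Complete : SRCColourable G 1 → Complete
  SRCColourable-1⇒Complete (c , c<1 , _ , rainbow) u v u≢v =
    let p , _ , p-rainbow = rainbow u v in adjacent p p-rainbow
    where
    adjacent : (p : Walk G u v) → IsRainbow G c p → Adj G u v
    adjacent stop                       _                = contradiction refl u≢v
    adjacent (step uv stop)             _                = uv
    adjacent (step uw (step wv _)) ((cuw≢cwv ∷ _) ∷ _) =
      contradiction (trans (n<1⇒n≡0 (c<1 _ _ uw)) (sym (n<1⇒n≡0 (c<1 _ _ wv)))) cuw≢cwv

  Complete⇒SRCListColourable-1 : Complete → SRCListColourable G 1
  Complete⇒SRCListColourable-1 complete L (L-sym , L-ok) =
    c , (λ u v uv → head₀-∈ (proj₂ (L-ok u v uv))) , (λ u v uv → cong head₀ (L-sym u v uv)) , rainbow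
    where
    c : EdgeColouring G
    c u v = head₀ (L u v)
    rainbow : ∀ u v → RainbowGeodesic c u v
    rainbow u v with u ≟ᶠ v
    ... | yes refl = rainbowGeodesic-refl c u
    ... | no  u≢v  = rainbowGeodesic-edge c u≢v (complete u v u≢v)

  src≡1⇒srcℓ≡1 : ∀ {b} → SrcIs G 1 → SrcListIs G b → b ≡ 1
  src≡1⇒srcℓ≡1 srcIs (colour , minimal) =
    ≤-antisym (minimal 1 (Complete⇒SRCListColourable-1 (SRCColourable-1⇒Complete (proj₁ srcIs))))
              (src≤srcℓ srcIs colour)

-- The apex fzero joined to the disjoint union of the cliques {x | class x ≡ j}.
module Cone {k : ℕ} (class : Fin k → ℕ) where

  Linked : Fin k → Fin k → Set
  Linked x y = x ≢ y × class x ≡ class y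

  linked? : Decidable Linked
  linked? x y = ¬? (x ≟ᶠ y) ×-dec (class x ≟ class y)

  linked-sym : ∀ {x y} → Linked x y → Linked y x
  linked-sym (x≢y , cx≡cy) = x≢y ∘ sym , sym cx≡cy

  adjacency : Fin (suc k) → Fin (suc k) → Bool
  adjacency fzero    fzero    = false
  adjacency fzero    (fsuc _) = true
  adjacency (fsuc _) fzero    = true
  adjacency (fsuc x) (fsuc y) = ⌊ linked? x y ⌋

  adjacency-sym : ∀ u v → adjacency u v ≡ adjacency v u
  adjacency-sym fzero    fzero    = refl
  adjacency-sym fzero    (fsuc _) = refl
  adjacency-sym (fsuc _) fzero    = refl
  adjacency-sym (fsuc x) (fsuc y) = begin
    ⌊ linked? x y ⌋    ≡⟨ isYes≗does (linked? x y) ⟩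
    does (linked? x y) ≡⟨ does-⇔ (mk⇔ linked-sym linked-sym) (linked? x y) (linked? y x) ⟩
    does (linked? y x) ≡⟨ isYes≗does (linked? y x) ⟨
    ⌊ linked? y x ⌋    ∎
    where open ≡-Reasoning

  adjacency-irrefl : ∀ u → adjacency u u ≡ false
  adjacency-irrefl fzero    = refl
  adjacency-irrefl (fsuc x) = trans (isYes≗does (linked? x x)) (dec-false (linked? x x) λ (x≢x , _) → x≢x refl)

  graph : Graph
  graph = record
    { n          = suc k
    ; adj        = adjacency
    ; adj-sym    = adjacency-sym
    ; adj-irrefl = adjacency-irrefl
    }

  Adj⇒sameClass : ∀ {x y} → Adj graph (fsuc x) (fsuc y) → class x ≡ class y
  Adj⇒sameClass {x} {y} x~y = proj₂ (toWitness {a? = linked? x y} x~y)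

  -- The only possible obstruction: vertices of different classes are at distance 2,
  -- and their only common neighbour is the apex.
  Separating : EdgeColouring graph → Set
  Separating c = ∀ x y → class x ≢ class y → c fzero (fsuc x) ≢ c fzero (fsuc y)

  separating⇒SRC : ∀ {c} → IsSymmetricOnEdges graph c → Separating c → StronglyRainbowConnected graph c
  separating⇒SRC {c} c-sym separating = c-sym , rainbow
    where
    rainbow : ∀ u v → RainbowGeodesic graph c u v
    rainbow u v with u ≟ᶠ v
    ... | yes refl = rainbowGeodesic-refl graph c u
    ... | no  u≢v  with T? (adjacency u v)
    ...   | yes uv = rainbowGeodesic-edge graph c u≢v uv
    rainbow fzero    fzero    | no u≢v | no ¬uv = contradiction refl u≢v
    rainbow fzero    (fsuc _) | no _   | no ¬uv = contradiction tt ¬uv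
    rainbow (fsuc _) fzero    | no _   | no ¬uv = contradiction tt ¬uv
    rainbow (fsuc x) (fsuc y) | no u≢v | no ¬uv =
      rainbowGeodesic-step² graph c tt tt (λ ()) (λ ()) u≢v ¬uv
        λ cx0≡c0y → separating x y cx≢cy (trans (sym (c-sym (fsuc x) fzero tt)) cx0≡c0y)
      where
      cx≢cy : class x ≢ class y
      cx≢cy cx≡cy = ¬uv (fromWitness {a? = linked? x y} (u≢v ∘ cong fsuc , cx≡cy))

  SRC⇒separating : ∀ {c} → StronglyRainbowConnected graph c → Separating c
  SRC⇒separating {c} (c-sym , rainbow) x y cx≢cy c0x≡c0y =
    let p , (_ , shortest) , p-rainbow = rainbow (fsuc x) (fsuc y)
    in  short p (shortest viaApex viaApex-isPath) p-rainbow
    where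
    x≢y : x ≢ y
    x≢y refl = cx≢cy refl
    viaApex : Walk graph (fsuc x) (fsuc y)
    viaApex = step {w = fzero} tt (step tt stop)
    viaApex-isPath : IsPath graph viaApex
    viaApex-isPath = step²-isPath graph tt tt (λ ()) (λ ()) (x≢y ∘ suc-injective)
    short : (p : Walk graph (fsuc x) (fsuc y)) → len graph p ≤ 2 → ¬ IsRainbow graph c p
    short stop                               _ _ = cx≢cy refl
    short (step xy stop)                     _ _ = cx≢cy (Adj⇒sameClass xy)
    short (step {w = fzero} _ (step _ stop)) _ ((cx0≢c0y ∷ []) ∷ _) =
      cx0≢c0y (trans (c-sym (fsuc x) fzero tt) c0x≡c0y)
    short (step {w = fsuc z} xz (step zy stop)) _ _ =
      cx≢cy (trans (Adj⇒sameClass xz) (Adj⇒sameClass zy))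
    short (step _ (step _ (step _ _))) (s≤s (s≤s ())) _

  classColouring : EdgeColouring graph
  classColouring fzero    fzero    = 0
  classColouring fzero    (fsuc y) = class y
  classColouring (fsuc x) _        = class x

  classColouring-SRC : StronglyRainbowConnected graph classColouring
  classColouring-SRC = separating⇒SRC symmetric λ _ _ cx≢cy → cx≢cy
    where
    symmetric : IsSymmetricOnEdges graph classColouring
    symmetric fzero    (fsuc _) _   = refl
    symmetric (fsuc _) fzero    _   = refl
    symmetric (fsuc _) (fsuc _) x~y = Adj⇒sameClass x~y

  SrcIs-cone : ∀ a → (∀ x → class x < a) → (∀ j → j < a → ∃ λ x → class x ≡ j) → SrcIs graph a
  SrcIs-cone a class<a onto = (classColouring , bounded , classColouring-SRC) , minimal
    where
    bounded : UsesAtMost graph a classColouring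
    bounded fzero    (fsuc y) _ = class<a y
    bounded (fsuc x) _        _ = class<a x

    rep : Fin a → Fin k
    rep j = proj₁ (onto (toℕ j) (toℕ<n j))

    minimal : ∀ r → SRCColourable graph r → a ≤ r
    minimal r (c , c<r , src) with a ≤? r
    ... | yes a≤r = a≤r
    ... | no  a≰r =
      let i , j , i<j , ci≡cj = pigeonhole (≰⇒> a≰r) colourOf
      in  contradiction (same-apexColour ci≡cj) (SRC⇒separating src (rep i) (rep j) (classes-differ i<j))
      where
      colourOf : Fin a → Fin r
      colourOf j = fromℕ< (c<r fzero (fsuc (rep j)) tt)
      same-apexColour : ∀ {i j} → colourOf i ≡ colourOf j → c fzero (fsuc (rep i)) ≡ c fzero (fsuc (rep j))
      same-apexColour e = trans (sym (toℕ-fromℕ< _)) (trans (cong toℕ e) (toℕ-fromℕ< _))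
      classes-differ : ∀ {i j} → toℕ i < toℕ j → class (rep i) ≢ class (rep j)
      classes-differ {i} {j} i<j e =
        <⇒≢ i<j (trans (sym (proj₂ (onto (toℕ i) (toℕ<n i)))) (trans e (proj₂ (onto (toℕ j) (toℕ<n j)))))

module _ {s t : ℕ} (class : Fin s ⊎ Fin t → ℕ) where
  open Cone (class ∘ splitAt s)

  -- The first s vertices get pairwise distinct apex colours, and the others, lying in one
  -- clique, avoid all of these.
  SRCListColourable-cone : (∀ y y′ → class (inj₂ y) ≡ class (inj₂ y′)) → SRCListColourable graph (suc s)
  SRCListColourable-cone oneClass L (L-sym , L-ok) = c , c∈L , separating⇒SRC c-sym separating
    where
    apexList : Fin (s + t) → List ℕ
    apexList x = L fzero (fsuc x)

    apexList-unique : ∀ x → Unique (apexList x)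
    apexList-unique x = proj₁ (L-ok fzero (fsuc x) tt)

    apexList-long : ∀ x → suc s ≤ length (apexList x)
    apexList-long x = proj₂ (L-ok fzero (fsuc x) tt)

    choiceS : ∃ λ (f : Fin s → ℕ) → (∀ i → f i ∈ apexList (i ↑ˡ t)) × Injective _≡_ _≡_ f
    choiceS = distinct-representatives s (apexList ∘ (_↑ˡ t)) (λ i → apexList-unique (i ↑ˡ t))
                (λ i → ≤-trans (n≤1+n s) (apexList-long (i ↑ˡ t)))

    colourS : Fin s → ℕ
    colourS = proj₁ choiceS

    choiceY : ∀ y → ∃ λ x → x ∈ apexList (s ↑ʳ y) × x ∉ tabulate colourS
    choiceY y = pigeonhole-∉ (apexList-unique (s ↑ʳ y))
                  (subst (_< length (apexList (s ↑ʳ y))) (sym (length-tabulate colourS)) (apexList-long (s ↑ʳ y)))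

    colourY : Fin t → ℕ
    colourY y = proj₁ (choiceY y)

    apexColour : Fin s ⊎ Fin t → ℕ
    apexColour = [ colourS , colourY ]′

    apexColour-∈ : ∀ x → apexColour (splitAt s x) ∈ apexList x
    apexColour-∈ x with splitAt s x in eq
    ... | inj₁ i = subst (λ z → colourS i ∈ apexList z) (splitAt⁻¹-↑ˡ eq) (proj₁ (proj₂ choiceS) i)
    ... | inj₂ y = subst (λ z → colourY y ∈ apexList z) (splitAt⁻¹-↑ʳ eq) (proj₁ (proj₂ (choiceY y)))

    colourS≢colourY : ∀ i y → colourS i ≢ colourY y
    colourS≢colourY i y e = proj₂ (proj₂ (choiceY y)) (subst (_∈ tabulate colourS) e (∈-tabulate⁺ i))

    apexColour-separating : ∀ p q → class p ≢ class q → apexColour p ≢ apexColour q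
    apexColour-separating (inj₁ i) (inj₁ j) ci≢cj e = ci≢cj (cong (class ∘ inj₁) (proj₂ (proj₂ choiceS) e))
    apexColour-separating (inj₁ i) (inj₂ y) _     e = colourS≢colourY i y e
    apexColour-separating (inj₂ y) (inj₁ i) _     e = colourS≢colourY i y (sym e)
    apexColour-separating (inj₂ y) (inj₂ z) cy≢cz _ = cy≢cz (oneClass y z)

    c : EdgeColouring graph
    c fzero    fzero    = 0
    c fzero    (fsuc x) = apexColour (splitAt s x)
    c (fsuc x) fzero    = apexColour (splitAt s x)
    c (fsuc x) (fsuc y) = head₀ (L (fsuc x) (fsuc y))

    c∈L : IsLColouring graph L c
    c∈L fzero    (fsuc x) _  = apexColour-∈ x
    c∈L (fsuc x) fzero    xo = subst (apexColour (splitAt s x) ∈_) (sym (L-sym (fsuc x) fzero xo)) (apexColour-∈ x)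
    c∈L (fsuc x) (fsuc y) xy = head₀-∈ (≤-trans (s≤s z≤n) (proj₂ (L-ok (fsuc x) (fsuc y) xy)))

    c-sym : IsSymmetricOnEdges graph c
    c-sym fzero    (fsuc _) _  = refl
    c-sym (fsuc _) fzero    _  = refl
    c-sym (fsuc x) (fsuc y) xy = cong head₀ (L-sym (fsuc x) (fsuc y) xy)

    separating : Separating c
    separating x y = apexColour-separating (splitAt s x) (splitAt s y)

module _ {s : ℕ} (class : Fin s ⊎ Fin (s ^ s) → ℕ) where
  open Cone (class ∘ splitAt s)

  -- Colour toℕ (combine i τ) encodes the pair (i, τ). Vertex i < s gets the block {(i, τ) | τ},
  -- and the vertex encoding σ : Fin s → Fin s (via finToFun) the transversal {(i, σ i) | i}.
  -- If vertex i receives (i, τ i), the vertex of τ can only repeat one of these colours.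
  ¬SRCListColourable-cone : (∀ i y → class (inj₁ i) ≢ class (inj₂ y)) → ¬ SRCListColourable graph s
  ¬SRCListColourable-cone classes-differ colour = noColouring (colour L (L-sym , L-ok))
    where
    code : Fin s → Fin s → ℕ
    code i τ = toℕ (combine i τ)

    apexList : Fin s ⊎ Fin (s ^ s) → List ℕ
    apexList = [ (λ i → tabulate (code i)) , (λ y → tabulate (λ i → code i (finToFun y i))) ]′

    apexList-unique : ∀ p → Unique (apexList p)
    apexList-unique (inj₁ i) = tabulate⁺ λ e → combine-injectiveʳ i _ i _ (toℕ-injective e)
    apexList-unique (inj₂ y) = tabulate⁺ λ e → combine-injectiveˡ _ _ _ _ (toℕ-injective e)

    apexList-length : ∀ p → length (apexList p) ≡ s
    apexList-length (inj₁ i) = length-tabulate (code i)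
    apexList-length (inj₂ y) = length-tabulate (λ i → code i (finToFun y i))

    L : EdgeListAssignment graph
    L fzero    fzero    = []
    L fzero    (fsuc x) = apexList (splitAt s x)
    L (fsuc x) fzero    = apexList (splitAt s x)
    L (fsuc _) (fsuc _) = upTo s

    L-sym : IsSymmetricOnEdges graph L
    L-sym fzero    (fsuc _) _ = refl
    L-sym (fsuc _) fzero    _ = refl
    L-sym (fsuc _) (fsuc _) _ = refl

    L-ok : ∀ u v → Adj graph u v → Unique (L u v) × s ≤ length (L u v)
    L-ok fzero    (fsuc x) _ = apexList-unique (splitAt s x) , ≤-reflexive (sym (apexList-length (splitAt s x)))
    L-ok (fsuc x) fzero    _ = apexList-unique (splitAt s x) , ≤-reflexive (sym (apexList-length (splitAt s x)))
    L-ok (fsuc _) (fsuc _) _ = upTo⁺ s , ≤-reflexive (sym (length-upTo s))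

    noColouring : ¬ (∃ λ c → IsLColouring graph L c × StronglyRainbowConnected graph c)
    noColouring (c , c∈L , src) =
      SRC⇒separating src (j ↑ˡ s ^ s) (s ↑ʳ y) classes-differ′ (sym colours-equal)
      where
      apexColour : Fin (s + s ^ s) → ℕ
      apexColour x = c fzero (fsuc x)

      choice : ∀ i → ∃ λ τ → apexColour (i ↑ˡ s ^ s) ≡ code i τ
      choice i = ∈-tabulate⁻ (subst (λ p → apexColour (i ↑ˡ s ^ s) ∈ apexList p) (splitAt-↑ˡ s i (s ^ s))
                                 (c∈L fzero (fsuc (i ↑ˡ s ^ s)) tt))

      τ : Fin s → Fin s
      τ i = proj₁ (choice i)

      y : Fin (s ^ s)
      y = funToFin τ

      hit : ∃ λ j → apexColour (s ↑ʳ y) ≡ code j (finToFun y j)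
      hit = ∈-tabulate⁻ (subst (λ p → apexColour (s ↑ʳ y) ∈ apexList p) (splitAt-↑ʳ s (s ^ s) y)
                           (c∈L fzero (fsuc (s ↑ʳ y)) tt))

      j : Fin s
      j = proj₁ hit

      colours-equal : apexColour (s ↑ʳ y) ≡ apexColour (j ↑ˡ s ^ s)
      colours-equal = begin
        apexColour (s ↑ʳ y)          ≡⟨ proj₂ hit ⟩
        code j (finToFun y j)        ≡⟨ cong (code j) (finToFun-funToFin τ j) ⟩
        code j (τ j)                 ≡⟨ proj₂ (choice j) ⟨
        apexColour (j ↑ˡ s ^ s)      ∎
        where open ≡-Reasoning

      classes-differ′ : class (splitAt s (j ↑ˡ s ^ s)) ≢ class (splitAt s (s ↑ʳ y))
      classes-differ′ e = classes-differ j y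
        (trans (sym (cong class (splitAt-↑ˡ s j (s ^ s)))) (trans e (cong class (splitAt-↑ʳ s (s ^ s) y))))

Realisable : ℕ → ℕ → Set
Realisable a b = Σ Graph (λ G → Nonempty G × Connected G × SrcIs G a × SrcListIs G b)

Admissible : ℕ → ℕ → Set
Admissible a b = (a ≡ 1 × b ≡ 1) ⊎ (2 ≤ a × a ≤ b)

Realisable⇒Admissible : ∀ {a b} → 1 ≤ a → Realisable a b → Admissible a b
Realisable⇒Admissible {suc zero}    _ (G , _ , _ , srcIs , srcListIs) =
  inj₁ (refl , src≡1⇒srcℓ≡1 G srcIs srcListIs)
Realisable⇒Admissible {suc (suc _)} _ (G , _ , _ , srcIs , colour , _) =
  inj₂ (s≤s (s≤s z≤n) , src≤srcℓ G srcIs colour)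

-- K₂, as the cone over a single vertex.
realisable-1-1 : Realisable 1 1
realisable-1-1 = graph , s≤s z≤n , SrcIs⇒Connected graph srcIs , srcIs , colour , λ _ → src≤srcℓ graph srcIs
  where
  class : Fin 0 ⊎ Fin 1 → ℕ
  class _ = 0
  open Cone (class ∘ splitAt 0)
  srcIs : SrcIs graph 1
  srcIs = SrcIs-cone 1 (λ _ → s≤s z≤n) (λ j j<1 → fzero , sym (n<1⇒n≡0 j<1))
  colour : SRCListColourable graph 1
  colour = SRCListColourable-cone class (λ _ _ → refl)

realisable-2+k-2+m : ∀ {k m} → k ≤ m → Realisable (2 + k) (2 + m)
realisable-2+k-2+m {k} {m} k≤m = graph , s≤s z≤n , SrcIs⇒Connected graph srcIs , srcIs , srcListIs
  where
  class : Fin (suc m) ⊎ Fin (suc m ^ suc m) → ℕ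
  class = [ (λ i → toℕ i ⊓ k) , (λ _ → suc k) ]′
  open Cone (class ∘ splitAt (suc m))

  class<2+k : ∀ p → class p < 2 + k
  class<2+k (inj₁ i) = s≤s (≤-trans (m⊓n≤n (toℕ i) k) (n≤1+n k))
  class<2+k (inj₂ _) = ≤-refl

  class-onto : ∀ j → j < 2 + k → ∃ λ x → class (splitAt (suc m) x) ≡ j
  class-onto j j<2+k with j ≤? k
  ... | yes j≤k =
    i ↑ˡ _ , trans (cong class (splitAt-↑ˡ (suc m) i _))
                   (trans (cong (_⊓ k) (toℕ-fromℕ< j<1+m)) (m≤n⇒m⊓n≡m j≤k))
    where
    j<1+m : j < suc m
    j<1+m = s≤s (≤-trans j≤k k≤m)
    i : Fin (suc m)
    i = fromℕ< j<1+m
  ... | no  j≰k =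
    suc m ↑ʳ funToFin {suc m} id ,
    trans (cong class (splitAt-↑ʳ (suc m) _ _)) (≤-antisym (≰⇒> j≰k) (s≤s⁻¹ j<2+k))

  srcIs : SrcIs graph (2 + k)
  srcIs = SrcIs-cone (2 + k) (class<2+k ∘ splitAt (suc m)) class-onto

  srcListIs : SrcListIs graph (2 + m)
  srcListIs = SrcListIs-suc graph (SRCListColourable-cone class (λ _ _ → refl))
                (¬SRCListColourable-cone class λ i _ → <⇒≢ (s≤s (m⊓n≤n (toℕ i) k)))

Admissible⇒Realisable : ∀ {a b} → Admissible a b → Realisable a b
Admissible⇒Realisable (inj₁ (refl , refl))                    = realisable-1-1
Admissible⇒Realisable (inj₂ (s≤s (s≤s z≤n) , s≤s (s≤s k≤m))) = realisable-2+k-2+m k≤m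

theorem4p2 : (a b : ℕ) → 1 ≤ a → 1 ≤ b →
    (Σ Graph (λ G → Nonempty G × Connected G × SrcIs G a × SrcListIs G b))
      ⇔ ((a ≡ 1 × b ≡ 1) ⊎ (2 ≤ a × a ≤ b))
theorem4p2 a b 1≤a _ = mk⇔ (Realisable⇒Admissible 1≤a) Admissible⇒Realisable
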